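{- If $x$ is any vertex of a connected graph $G$ of order $n$, then \[A(G,x)\geq \frac{n+1}{2}.\]
   Context: A subset $U$ of the vertex set of $G$ is a connected set if the subgraph of $G$ induced by $U$ is connected. $N(G,x)$ denotes the number of connected sets of $G$ containing $x$, $S(G,x)$ the sum of the sizes of the connected sets of $G$ containing $x$, and $A(G,x)=S(G,x)/N(G,x)$. -}

module Defs where

open import Data.Nat using (ℕ; suc; _+_)
open import Data.Fin using (Fin)
open import Data.Fin.Subset using (Subset; _∈_; ∣_∣; ⊤)
open import Data.List using (List; []; _∷_; map; length)
open import Data.Nat.ListAction using (sum)
open import Data.List.Relation.Unary.Unique.Propositional using (Unique)
import Data.List.Membership.Propositional as LM
open import Data.Product using (_×_; Σ)
open import Relation.Nullary using (¬_)
open import Relation.Binary.PropositionalEquality using (_≡_)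

record Graph (n : ℕ) : Set₁ where
  field
    Adj   : Fin n → Fin n → Set
    irrefl : ∀ {u} → ¬ Adj u u
    sym    : ∀ {u v} → Adj u v → Adj v u
open Graph public

data WalkIn {n : ℕ} (G : Graph n) (U : Subset n) : Fin n → Fin n → Set where
  here : ∀ {u} → u ∈ U → WalkIn G U u u
  step : ∀ {u w v} → u ∈ U → Adj G u w → WalkIn G U w v → WalkIn G U u v

-- G[U] is connected (U nonempty is not required here; the sets we consider contain x).
ConnectedSet : {n : ℕ} → Graph n → Subset n → Set
ConnectedSet G U = ∀ {u v} → u ∈ U → v ∈ U → WalkIn G U u v

Connected : {n : ℕ} → Graph n → Set
Connected {n} G = ∀ (u v : Fin n) → WalkIn G ⊤ u v

IsConnSetsAt : {n : ℕ} → Graph n → Fin n → List (Subset n) → Set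
IsConnSetsAt G x L =
  Unique L × (∀ U → (U LM.∈ L → x ∈ U × ConnectedSet G U) × (x ∈ U → ConnectedSet G U → U LM.∈ L))

Nsets : {n : ℕ} → List (Subset n) → ℕ
Nsets L = length L

Ssizes : {n : ℕ} → List (Subset n) → ℕ
Ssizes L = sum (map ∣_∣ L)

-- Clearing denominators, the claim is (n + 1) N ≤ 2 S, i.e. Σ_U (n − |U|) ≤ Σ_U (|U| − 1) over
-- the connected sets U containing x: there are at most as many pairs (U , w) with w ∉ U as pairs
-- (T , a) with a ∈ T − x.  Map (U , w) to (U ∪ P , a), where P is a shortest path in G from U to w
-- and a is its first vertex.  No vertex of P other than a is adjacent to U, so U is recovered as
-- the set of vertices reachable from x in U ∪ P without passing through a; and w is the vertex of
-- P farthest from U.  Hence the map is injective.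
module Submission where

open import Defs

open import Level using (Level)
open import Data.Nat using (ℕ; zero; suc; _+_; _*_; _≤_; z≤n; s≤s)
open import Data.Nat.Properties
  using ( +-comm; +-assoc; +-identityʳ; *-zeroʳ; *-identityˡ; *-suc; m∸n+n≡m; ≤-total; m≤n⇒m<n∨m≡n
        ; +-monoʳ-≤; +-monoˡ-≤; +-commutativeSemigroup; module ≤-Reasoning )
open import Algebra.Properties.CommutativeSemigroup +-commutativeSemigroup using (interchange)
open import Data.Nat.ListAction using (sum)
open import Data.Bool using (true; false) renaming (_≟_ to _≟ᵇ_)
open import Data.Fin using (Fin; zero; suc; _≟_)
open import Data.Fin.Subset using (Subset; inside; outside; _∈_; _∉_; _⊆_; _∪_; ⁅_⁆; ⊤; ∁; _-_; ∣_∣)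
open import Data.Fin.Subset.Properties
  using ( _∈?_; ⊆-antisym; p⊆p∪q; q⊆p∪q; x∈p∪q⁻; x∈⁅x⁆; x∈⁅y⁆⇒x≡y; x∈∁p⇒x∉p
        ; x∈p∧x≢y⇒x∈p-y; p─⊥≡p; ∣∁p∣≡n∸∣p∣; ∣p∣≤n )
import Data.Vec as Vec
open import Data.Vec using ([]; _∷_)
open import Data.Vec.Properties using (≡-dec; lookup∘tabulate; lookup⇒[]=; []=⇒lookup)
open import Data.List using (List; []; _∷_; length; map; _++_; concatMap; filter; allFin; tabulate)
open import Data.List.Properties using (length-++; length-map; length-removeAt′; map-tabulate)
import Data.List.Membership.Propositional as LM
open LM using (_─_)
open import Data.List.Membership.Propositional.Properties
  using (∈-++⁺ˡ; ∈-++⁺ʳ; ∈-++⁻; ∈-map⁺; ∈-map⁻; ∈-filter⁺; ∈-filter⁻; ∈-allFin)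
open import Data.List.Relation.Unary.All as All using (All; []; _∷_)
open import Data.List.Relation.Unary.Any using (here; there; index)
open import Data.List.Relation.Unary.AllPairs using ([]; _∷_)
open import Data.List.Relation.Unary.Unique.Propositional using (Unique)
import Data.List.Relation.Unary.Unique.Propositional.Properties as Unique
open import Data.Product using (∃₂; ∃-syntax; _×_; _,_; proj₁; proj₂)
open import Data.Sum using (_⊎_; inj₁; inj₂)
open import Function using (_∘_; const; id)
open import Relation.Nullary using (¬_; yes; no; does; contradiction)
open import Relation.Nullary.Decidable using (dec-true)
open import Relation.Unary using (Decidable)
import Relation.Binary.PropositionalEquality as ≡
open ≡ using (_≡_; _≢_; refl; trans; cong; cong₂; module ≡-Reasoning)

private
  variable
    a b p r : Level
    A : Set a
    B : Set b
    n : ℕ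

∈-─ : ∀ {y z : A} {ys} (y∈ys : y LM.∈ ys) → z LM.∈ ys → z ≢ y → z LM.∈ ys ─ y∈ys
∈-─ (here refl) (here refl) z≢y = contradiction refl z≢y
∈-─ (here _)    (there z∈)  _   = z∈
∈-─ (there _)   (here z≡)   _   = here z≡
∈-─ (there y∈)  (there z∈)  z≢y = there (∈-─ y∈ z∈ z≢y)

length-≤-of-injection : ∀ {R : A → B → Set r} {xs ys} → Unique xs →
  (∀ {x} → x LM.∈ xs → ∃[ y ] y LM.∈ ys × R x y) →
  (∀ {x x′ y} → x LM.∈ xs → x′ LM.∈ xs → R x y → R x′ y → x ≡ x′) →
  length xs ≤ length ys
length-≤-of-injection {xs = []} _ _ _ = z≤n
length-≤-of-injection {R = R} {x ∷ xs} {ys} (x∉xs ∷ xs!) image injective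
  with y , y∈ys , Rxy ← image (here refl) rewrite length-removeAt′ ys (index y∈ys) =
  s≤s (length-≤-of-injection xs! image′ (λ p q → injective (there p) (there q)))
  where
  image′ : ∀ {x′} → x′ LM.∈ xs → ∃[ y′ ] y′ LM.∈ ys ─ y∈ys × R x′ y′
  image′ x′∈xs with y′ , y′∈ys , Rx′y′ ← image (there x′∈xs) =
    y′ , ∈-─ y∈ys y′∈ys y′≢y , Rx′y′
    where
    y′≢y : y′ ≢ y
    y′≢y refl = All.lookup x∉xs x′∈xs (injective (here refl) (there x′∈xs) Rxy Rx′y′)

pairsOver : (A → List B) → List A → List (A × B)
pairsOver f = concatMap (λ x → map (x ,_) (f x))

module _ {f : A → List B} where

  ∈-pairsOver⁺ : ∀ {x y xs} → x LM.∈ xs → y LM.∈ f x → (x , y) LM.∈ pairsOver f xs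
  ∈-pairsOver⁺ {xs = x ∷ _}  (here refl)  y∈fx = ∈-++⁺ˡ (∈-map⁺ (x ,_) y∈fx)
  ∈-pairsOver⁺ {xs = z ∷ _}  (there x∈xs) y∈fx = ∈-++⁺ʳ (map (z ,_) (f z)) (∈-pairsOver⁺ x∈xs y∈fx)

  ∈-pairsOver⁻ : ∀ {x y} xs → (x , y) LM.∈ pairsOver f xs → x LM.∈ xs × y LM.∈ f x
  ∈-pairsOver⁻ (z ∷ xs) xy∈ with ∈-++⁻ (map (z ,_) (f z)) xy∈
  ... | inj₁ xy∈block with _ , y∈fz , refl ← ∈-map⁻ (z ,_) xy∈block = here refl , y∈fz
  ... | inj₂ xy∈rest  with x∈xs , y∈fx ← ∈-pairsOver⁻ xs xy∈rest   = there x∈xs , y∈fx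

  pairsOver-unique : ∀ {xs} → Unique xs → (∀ x → Unique (f x)) → Unique (pairsOver f xs)
  pairsOver-unique [] _ = []
  pairsOver-unique {z ∷ xs} (z∉xs ∷ xs!) f! =
    Unique.++⁺ (Unique.map⁺ (cong proj₂) (f! z)) (pairsOver-unique xs! f!) disjoint
    where
    disjoint : ∀ {q} → ¬ (q LM.∈ map (z ,_) (f z) × q LM.∈ pairsOver f xs)
    disjoint (q∈block , q∈rest) with _ , _ , refl ← ∈-map⁻ (z ,_) q∈block =
      All.lookup z∉xs (proj₁ (∈-pairsOver⁻ xs q∈rest)) refl

  length-pairsOver : ∀ {g h : A → ℕ} xs → All (λ x → length (f x) + g x ≡ h x) xs →
    length (pairsOver f xs) + sum (map g xs) ≡ sum (map h xs)
  length-pairsOver [] [] = refl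
  length-pairsOver {g} {h} (x ∷ xs) (eq ∷ eqs) = begin
    length (map (x ,_) (f x) ++ pairsOver f xs) + (g x + sum (map g xs))
      ≡⟨ cong (_+ _) (length-++ (map (x ,_) (f x))) ⟩
    (length (map (x ,_) (f x)) + length (pairsOver f xs)) + (g x + sum (map g xs))
      ≡⟨ cong (λ m → (m + _) + _) (length-map (x ,_) (f x)) ⟩
    (length (f x) + length (pairsOver f xs)) + (g x + sum (map g xs))
      ≡⟨ interchange (length (f x)) _ (g x) _ ⟩
    (length (f x) + g x) + (length (pairsOver f xs) + sum (map g xs))
      ≡⟨ cong₂ _+_ eq (length-pairsOver xs eqs) ⟩
    h x + sum (map h xs)
      ∎
    where open ≡-Reasoning

sum-map-const : ∀ c (xs : List A) → sum (map (const c) xs) ≡ c * length xs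
sum-map-const c []       = ≡.sym (*-zeroʳ c)
sum-map-const c (_ ∷ xs) = trans (cong (c +_) (sum-map-const c xs)) (≡.sym (*-suc c (length xs)))

firstCrossing : ∀ {P : ℕ → Set p} → Decidable P → ∀ K → ¬ P 0 → P K → ∃[ k ] ¬ P k × P (suc k)
firstCrossing P? zero    ¬P0 PK = contradiction PK ¬P0
firstCrossing P? (suc K) ¬P0 PK with P? K
... | yes PK′ = firstCrossing P? K ¬P0 PK′
... | no ¬PK′ = K , ¬PK′ , PK

module _ {P : Fin n → Set p} (P? : Decidable P) where

  subsetOf : Subset n
  subsetOf = Vec.tabulate (does ∘ P?)

  ∈-subsetOf⁺ : ∀ {v} → P v → v ∈ subsetOf
  ∈-subsetOf⁺ {v} Pv = lookup⇒[]= v subsetOf (trans (lookup∘tabulate (does ∘ P?) v) (dec-true (P? v) Pv))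

  ∈-subsetOf⁻ : ∀ {v} → v ∈ subsetOf → P v
  ∈-subsetOf⁻ {v} v∈ with P? v | trans (≡.sym (lookup∘tabulate (does ∘ P?) v)) ([]=⇒lookup v∈)
  ... | yes Pv | _ = Pv
  ... | no _   | ()

elements : Subset n → List (Fin n)
elements p = filter (_∈? p) (allFin _)

module _ {p : Subset n} where

  ∈-elements⁺ : ∀ {v} → v ∈ p → v LM.∈ elements p
  ∈-elements⁺ {v} v∈p = ∈-filter⁺ (_∈? p) (∈-allFin v) v∈p

  ∈-elements⁻ : ∀ {v} → v LM.∈ elements p → v ∈ p
  ∈-elements⁻ v∈ = proj₂ (∈-filter⁻ (_∈? p) {xs = allFin _} v∈)

elements-unique : (p : Subset n) → Unique (elements p)
elements-unique p = Unique.filter⁺ (_∈? p) (Unique.allFin⁺ _)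

length-filter-∈?-map-suc : ∀ s (p : Subset n) xs →
  length (filter (_∈? (s ∷ p)) (map suc xs)) ≡ length (filter (_∈? p) xs)
length-filter-∈?-map-suc s p [] = refl
length-filter-∈?-map-suc s p (v ∷ xs) with does (v ∈? p)
... | true  = cong suc (length-filter-∈?-map-suc s p xs)
... | false = length-filter-∈?-map-suc s p xs

length-filter-∈?-∷ : ∀ s (p : Subset n) → length (filter (_∈? (s ∷ p)) (tabulate suc)) ≡ length (elements p)
length-filter-∈?-∷ s p = begin
  length (filter (_∈? (s ∷ p)) (tabulate suc))       ≡⟨ cong (length ∘ filter (_∈? (s ∷ p))) (map-tabulate id suc) ⟨
  length (filter (_∈? (s ∷ p)) (map suc (allFin _))) ≡⟨ length-filter-∈?-map-suc s p (allFin _) ⟩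
  length (elements p)                                ∎
  where open ≡-Reasoning

length-elements : (p : Subset n) → length (elements p) ≡ ∣ p ∣
length-elements []            = refl
length-elements (inside  ∷ p) = cong suc (trans (length-filter-∈?-∷ inside p) (length-elements p))
length-elements (outside ∷ p) = trans (length-filter-∈?-∷ outside p) (length-elements p)

∣∁p∣+∣p∣≡n : (p : Subset n) → ∣ ∁ p ∣ + ∣ p ∣ ≡ n
∣∁p∣+∣p∣≡n p = trans (cong (_+ ∣ p ∣) (∣∁p∣≡n∸∣p∣ p)) (m∸n+n≡m (∣p∣≤n p))

x∈p⇒suc∣p-x∣≡∣p∣ : ∀ {x} {p : Subset n} → x ∈ p → suc ∣ p - x ∣ ≡ ∣ p ∣
x∈p⇒suc∣p-x∣≡∣p∣ {x = zero}  {inside  ∷ p} Vec.here        = cong (suc ∘ ∣_∣) (p─⊥≡p p)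
x∈p⇒suc∣p-x∣≡∣p∣ {x = suc _} {inside  ∷ _} (Vec.there x∈p) = cong suc (x∈p⇒suc∣p-x∣≡∣p∣ x∈p)
x∈p⇒suc∣p-x∣≡∣p∣ {x = suc _} {outside ∷ _} (Vec.there x∈p) = x∈p⇒suc∣p-x∣≡∣p∣ x∈p

x∈p∪⁅y⁆∧x≢y⇒x∈p : ∀ {p : Subset n} {x y} → x ∈ p ∪ ⁅ y ⁆ → x ≢ y → x ∈ p
x∈p∪⁅y⁆∧x≢y⇒x∈p {p = p} {y = y} x∈ x≢y with x∈p∪q⁻ p ⁅ y ⁆ x∈
... | inj₁ x∈p   = x∈p
... | inj₂ x∈⁅y⁆ = contradiction (x∈⁅y⁆⇒x≡y y x∈⁅y⁆) x≢y

outsidePairs : List (Subset n) → List (Subset n × Fin n)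
outsidePairs = pairsOver (elements ∘ ∁)

insidePairs : Fin n → List (Subset n) → List (Subset n × Fin n)
insidePairs x = pairsOver (λ T → elements (T - x))

length-outsidePairs : (Us : List (Subset n)) → length (outsidePairs Us) + Ssizes Us ≡ n * length Us
length-outsidePairs {n} Us =
  trans (length-pairsOver Us (All.tabulate λ {U} _ → outside+inside U)) (sum-map-const n Us)
  where
  outside+inside : ∀ U → length (elements (∁ U)) + ∣ U ∣ ≡ n
  outside+inside U = trans (cong (_+ ∣ U ∣) (length-elements (∁ U))) (∣∁p∣+∣p∣≡n U)

length-insidePairs : ∀ {x : Fin n} {Us} → All (x ∈_) Us → length (insidePairs x Us) + length Us ≡ Ssizes Us
length-insidePairs {x = x} {Us} x∈Us = begin
  length (insidePairs x Us) + length Us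
    ≡⟨ cong (length (insidePairs x Us) +_) (trans (sum-map-const 1 Us) (*-identityˡ _)) ⟨
  length (insidePairs x Us) + sum (map (const 1) Us)
    ≡⟨ length-pairsOver Us (All.map others+root x∈Us) ⟩
  Ssizes Us
    ∎
  where
  open ≡-Reasoning
  others+root : ∀ {T} → x ∈ T → length (elements (T - x)) + 1 ≡ ∣ T ∣
  others+root {T} x∈T = trans (+-comm _ 1) (trans (cong suc (length-elements (T - x))) (x∈p⇒suc∣p-x∣≡∣p∣ x∈T))

module _ (G : Graph n) where

  walk-source : ∀ {X u v} → WalkIn G X u v → u ∈ X
  walk-source (here u∈X)     = u∈X
  walk-source (step u∈X _ _) = u∈X

  walk-target : ∀ {X u v} → WalkIn G X u v → v ∈ X
  walk-target (here v∈X)   = v∈X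
  walk-target (step _ _ w) = walk-target w

  walk-mono : ∀ {X Y u v} → X ⊆ Y → WalkIn G X u v → WalkIn G Y u v
  walk-mono X⊆Y (here u∈X)      = here (X⊆Y u∈X)
  walk-mono X⊆Y (step u∈X uw w) = step (X⊆Y u∈X) uw (walk-mono X⊆Y w)

  walk-++ : ∀ {X u v w} → WalkIn G X u v → WalkIn G X v w → WalkIn G X u w
  walk-++ (here _)        w′ = w′
  walk-++ (step u∈X uw w) w′ = step u∈X uw (walk-++ w w′)

  walk-snoc : ∀ {X u v w} → WalkIn G X u v → Adj G v w → w ∈ X → WalkIn G X u w
  walk-snoc w vw w∈X = walk-++ w (step (walk-target w) vw (here w∈X))

  walk-reverse : ∀ {X u v} → WalkIn G X u v → WalkIn G X v u
  walk-reverse (here u∈X)      = here u∈X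
  walk-reverse (step u∈X uw w) = walk-snoc (walk-reverse w) (Graph.sym G uw) u∈X

  walk-confined : ∀ {U X s v} → (∀ {u z} → u ∈ U → Adj G u z → z ∈ X → z ∈ U) →
    WalkIn G X s v → s ∈ U → v ∈ U
  walk-confined closed (here _)      s∈U = s∈U
  walk-confined closed (step _ sw w) s∈U = walk-confined closed w (closed s∈U sw (walk-source w))

  connectedSet-fromRoot : ∀ {X r} → r ∈ X → (∀ {v} → v ∈ X → WalkIn G X r v) → ConnectedSet G X
  connectedSet-fromRoot _ walkFrom u∈X v∈X = walk-++ (walk-reverse (walkFrom u∈X)) (walkFrom v∈X)

  connectedSet-∪⁅⁆ : ∀ {U y v} → ConnectedSet G U → y ∈ U → Adj G y v → ConnectedSet G (U ∪ ⁅ v ⁆)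
  connectedSet-∪⁅⁆ {U} {y} {v} U-conn y∈U yv = connectedSet-fromRoot (p⊆p∪q ⁅ v ⁆ y∈U) walkFrom-y
    where
    walkFrom-y : ∀ {z} → z ∈ U ∪ ⁅ v ⁆ → WalkIn G (U ∪ ⁅ v ⁆) y z
    walkFrom-y z∈ with x∈p∪q⁻ U ⁅ v ⁆ z∈
    ... | inj₁ z∈U   = walk-mono (p⊆p∪q ⁅ v ⁆) (U-conn y∈U z∈U)
    ... | inj₂ z∈⁅v⁆ with refl ← x∈⁅y⁆⇒x≡y v z∈⁅v⁆ = walk-snoc (here (p⊆p∪q ⁅ v ⁆ y∈U)) yv z∈

  connectedSet-∪⁅⁆⇒adjacent : ∀ {U u v} → ConnectedSet G (U ∪ ⁅ v ⁆) → u ∈ U → v ∉ U →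
    ∃[ y ] y ∈ U × Adj G y v
  connectedSet-∪⁅⁆⇒adjacent {U} {u} {v} conn u∈U v∉U
    with conn (q⊆p∪q U ⁅ v ⁆ (x∈⁅x⁆ v)) (p⊆p∪q ⁅ v ⁆ u∈U)
  ... | here _ = contradiction u∈U v∉U
  ... | step {w = t} _ vt w with x∈p∪q⁻ U ⁅ v ⁆ (walk-source w)
  ...   | inj₁ t∈U   = t , t∈U , Graph.sym G vt
  ...   | inj₂ t∈⁅v⁆ with refl ← x∈⁅y⁆⇒x≡y v t∈⁅v⁆ = contradiction vt (Graph.irrefl G)

module ConnectedSetsAt (G : Graph n) (x : Fin n) (L : List (Subset n)) (L-enumerates : IsConnSetsAt G x L) where

  Listed : Subset n → Set
  Listed U = U LM.∈ L

  listed? : Decidable Listed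
  listed? U = U ∈ₗ? L
    where open import Data.List.Membership.DecPropositional (≡-dec _≟ᵇ_) using () renaming (_∈?_ to _∈ₗ?_)

  root∈listed : ∀ {U} → Listed U → x ∈ U
  root∈listed {U} = proj₁ ∘ proj₁ (proj₂ L-enumerates U)

  listed⇒connectedSet : ∀ {U} → Listed U → ConnectedSet G U
  listed⇒connectedSet {U} = proj₂ ∘ proj₁ (proj₂ L-enumerates U)

  walkFromRoot : ∀ {U v} → Listed U → v ∈ U → WalkIn G U x v
  walkFromRoot U∈L = listed⇒connectedSet U∈L (root∈listed U∈L)

  connectedSet⇒listed : ∀ {U} → x ∈ U → ConnectedSet G U → Listed U
  connectedSet⇒listed {U} = proj₂ (proj₂ L-enumerates U)

  listed-∪⁅⁆ : ∀ {U y v} → Listed U → y ∈ U → Adj G y v → Listed (U ∪ ⁅ v ⁆)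
  listed-∪⁅⁆ {v = v} U∈L y∈U yv =
    connectedSet⇒listed (p⊆p∪q ⁅ v ⁆ (root∈listed U∈L)) (connectedSet-∪⁅⁆ G (listed⇒connectedSet U∈L) y∈U yv)

  -- Adj need not be decidable, but for listed B and v ∉ B this decides whether v is adjacent to B.
  extends? : (B : Subset n) → Decidable (λ v → Listed (B ∪ ⁅ v ⁆))
  extends? B v = listed? (B ∪ ⁅ v ⁆)

  module _ (U : Subset n) where

    -- For listed U: the vertices at distance ≤ k from U.
    ball : ℕ → Subset n
    ball zero    = U
    ball (suc k) = ball k ∪ subsetOf (extends? (ball k))

    ball-suc⁻ : ∀ k {v} → v ∈ ball (suc k) → v ∈ ball k ⊎ Listed (ball k ∪ ⁅ v ⁆)
    ball-suc⁻ k v∈ with x∈p∪q⁻ (ball k) _ v∈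
    ... | inj₁ v∈ball = inj₁ v∈ball
    ... | inj₂ v∈new  = inj₂ (∈-subsetOf⁻ (extends? (ball k)) v∈new)

    ball⊆ball-suc : ∀ k → ball k ⊆ ball (suc k)
    ball⊆ball-suc k = p⊆p∪q _

    ball-mono : ∀ {k k′} → k ≤ k′ → ball k ⊆ ball k′
    ball-mono {k′ = zero}   z≤n = id
    ball-mono {k′ = suc k′} k≤k′ with m≤n⇒m<n∨m≡n k≤k′
    ... | inj₁ (s≤s k≤k′) = ball⊆ball-suc k′ ∘ ball-mono k≤k′
    ... | inj₂ refl       = id

    ball-listed : Listed U → ∀ k → Listed (ball k)
    ball-listed U∈L zero    = U∈L
    ball-listed U∈L (suc k) =
      connectedSet⇒listed (ball⊆ball-suc k x∈Bₖ) (connectedSet-fromRoot G (ball⊆ball-suc k x∈Bₖ) walkFrom-x)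
      where
      Bₖ : Subset n
      Bₖ = ball k
      Bₖ∈L : Listed Bₖ
      Bₖ∈L = ball-listed U∈L k
      x∈Bₖ : x ∈ Bₖ
      x∈Bₖ = root∈listed Bₖ∈L
      walkFrom-x : ∀ {v} → v ∈ ball (suc k) → WalkIn G (ball (suc k)) x v
      walkFrom-x {v} v∈ with ball-suc⁻ k v∈
      ... | inj₁ v∈B   = walk-mono G (ball⊆ball-suc k) (walkFromRoot Bₖ∈L v∈B)
      ... | inj₂ B∪v∈L = walk-mono G B∪v⊆ (walkFromRoot B∪v∈L (q⊆p∪q Bₖ ⁅ v ⁆ (x∈⁅x⁆ v)))
        where
        B∪v⊆ : Bₖ ∪ ⁅ v ⁆ ⊆ ball (suc k)
        B∪v⊆ z∈ with x∈p∪q⁻ Bₖ _ z∈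
        ... | inj₁ z∈B   = ball⊆ball-suc k z∈B
        ... | inj₂ z∈⁅v⁆ with refl ← x∈⁅y⁆⇒x≡y v z∈⁅v⁆ = v∈

    ball-suc-adjacent : Listed U → ∀ k {v t} → v ∈ ball k → Adj G v t → t ∈ ball (suc k)
    ball-suc-adjacent U∈L k v∈ball vt =
      q⊆p∪q (ball k) _ (∈-subsetOf⁺ (extends? (ball k)) (listed-∪⁅⁆ (ball-listed U∈L k) v∈ball vt))

    ball-suc-parent : Listed U → ∀ k {t} → t ∈ ball (suc k) → t ∉ ball k → ∃[ y ] y ∈ ball k × Adj G y t
    ball-suc-parent U∈L k t∈ t∉ with ball-suc⁻ k t∈
    ... | inj₁ t∈B   = contradiction t∈B t∉
    ... | inj₂ B∪t∈L =
      connectedSet-∪⁅⁆⇒adjacent G (listed⇒connectedSet B∪t∈L) (root∈listed (ball-listed U∈L k)) t∉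

    walk⇒∈ball : Listed U → ∀ {j s t} → WalkIn G ⊤ s t → s ∈ ball j → ∃[ k ] t ∈ ball k
    walk⇒∈ball U∈L {j} (here _)      s∈ = j , s∈
    walk⇒∈ball U∈L {j} (step _ st w) s∈ = walk⇒∈ball U∈L {suc j} w (ball-suc-adjacent U∈L j s∈ st)

    Closer : Fin n → Fin n → Set
    Closer z w = ∃[ r ] z ∈ ball r × w ∉ ball r

    closer-irrefl : ∀ {w} → ¬ Closer w w
    closer-irrefl (_ , w∈ , w∉) = w∉ w∈

    closer-trans : ∀ {y z w} → Closer y z → Closer z w → Closer y w
    closer-trans (r , y∈ , z∉) (s , z∈ , w∉) with ≤-total r s
    ... | inj₁ r≤s = s , ball-mono r≤s y∈ , w∉
    ... | inj₂ s≤r = contradiction (ball-mono s≤r z∈) z∉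

    -- T is U together with a shortest path a ⋯ w from U to w.
    record ShortestPathExtension (w : Fin n) (T : Subset n) (a : Fin n) : Set where
      field
        T-listed        : Listed T
        U⊆T             : U ⊆ T
        w∈T             : w ∈ T
        w∉U             : w ∉ U
        a∈T             : a ∈ T
        a∉U             : a ∉ U
        U-closed        : ∀ {u z} → u ∈ U → Adj G u z → z ∈ T → z ≢ a → z ∈ U
        interior-closer : ∀ {z} → z ∈ T → z ∉ U → z ≢ w → Closer z w

    shortestPathExtension : Listed U → ∀ k {w} → w ∉ ball k → w ∈ ball (suc k) → ∃₂ (ShortestPathExtension w)
    shortestPathExtension U∈L zero {w} w∉U w∈ with ball-suc⁻ 0 w∈
    ... | inj₁ w∈U   = contradiction w∈U w∉U
    ... | inj₂ U∪w∈L = U ∪ ⁅ w ⁆ , w , record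
      { T-listed        = U∪w∈L
      ; U⊆T             = p⊆p∪q _
      ; w∈T             = w∈U∪w
      ; w∉U             = w∉U
      ; a∈T             = w∈U∪w
      ; a∉U             = w∉U
      ; U-closed        = λ _ _ z∈ z≢w → x∈p∪⁅y⁆∧x≢y⇒x∈p z∈ z≢w
      ; interior-closer = λ z∈ z∉U z≢w → contradiction (x∈p∪⁅y⁆∧x≢y⇒x∈p z∈ z≢w) z∉U
      }
      where w∈U∪w = q⊆p∪q U ⁅ w ⁆ (x∈⁅x⁆ w)
    shortestPathExtension U∈L (suc k) {w} w∉ w∈
      with y , y∈ , yw ← ball-suc-parent U∈L (suc k) w∈ w∉
      with T , a , ext ← shortestPathExtension U∈L k (λ y∈k → w∉ (ball-suc-adjacent U∈L k y∈k yw)) y∈ =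
      T ∪ ⁅ w ⁆ , a , record
      { T-listed        = listed-∪⁅⁆ T-listed w∈T yw
      ; U⊆T             = p⊆p∪q _ ∘ U⊆T
      ; w∈T             = q⊆p∪q T ⁅ w ⁆ (x∈⁅x⁆ w)
      ; w∉U             = w∉ ∘ ball-mono {k′ = suc k} z≤n
      ; a∈T             = p⊆p∪q _ a∈T
      ; a∉U             = a∉U
      ; U-closed        = closed
      ; interior-closer = closer
      }
      where
      open ShortestPathExtension ext
      y-closer : Closer y w
      y-closer = suc k , y∈ , w∉
      closed : ∀ {u z} → u ∈ U → Adj G u z → z ∈ T ∪ ⁅ w ⁆ → z ≢ a → z ∈ U
      closed u∈U uz z∈ z≢a with x∈p∪q⁻ T _ z∈
      ... | inj₁ z∈T   = U-closed u∈U uz z∈T z≢a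
      ... | inj₂ z∈⁅w⁆ with refl ← x∈⁅y⁆⇒x≡y _ z∈⁅w⁆ =
        contradiction (ball-mono {k′ = suc k} (s≤s z≤n) (ball-suc-adjacent U∈L 0 u∈U uz)) w∉
      closer : ∀ {z} → z ∈ T ∪ ⁅ w ⁆ → z ∉ U → z ≢ w → Closer z w
      closer {z} z∈ z∉U z≢w with z ≟ y
      ... | yes refl = y-closer
      ... | no z≢y   = closer-trans (interior-closer (x∈p∪⁅y⁆∧x≢y⇒x∈p z∈ z≢w) z∉U z≢y) y-closer

    shortestPathExtension-exists : Connected G → Listed U → ∀ {w} → w ∉ U → ∃₂ (ShortestPathExtension w)
    shortestPathExtension-exists connected U∈L {w} w∉U
      with K , w∈K ← walk⇒∈ball U∈L {0} (connected x w) (root∈listed U∈L)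
      with k , w∉k , w∈k+1 ← firstCrossing {P = λ k → w ∈ ball k} (λ k → w ∈? ball k) K w∉U w∈K =
      shortestPathExtension U∈L k w∉k w∈k+1

  -- A walk from x inside U′ avoids a, and inside T the set U can only be left through a.
  shortestPathExtension-base⊆ : ∀ {U U′ w w′ T a} → Listed U → Listed U′ →
    ShortestPathExtension U w T a → ShortestPathExtension U′ w′ T a → U′ ⊆ U
  shortestPathExtension-base⊆ {U} {U′} U∈L U′∈L ext ext′ v∈U′ =
    walk-confined G closed (walkFromRoot U′∈L v∈U′) (root∈listed U∈L)
    where
    open ShortestPathExtension
    closed : ∀ {u z} → u ∈ U → Adj G u z → z ∈ U′ → z ∈ U
    closed u∈U uz z∈U′ = U-closed ext u∈U uz (U⊆T ext′ z∈U′) (λ { refl → a∉U ext′ z∈U′ })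

  shortestPathExtension-injective : ∀ {U U′ w w′ T a} → Listed U → Listed U′ →
    ShortestPathExtension U w T a → ShortestPathExtension U′ w′ T a → (U , w) ≡ (U′ , w′)
  shortestPathExtension-injective {U} {w = w} {w′} U∈L U′∈L ext ext′
    with refl ← ⊆-antisym (shortestPathExtension-base⊆ U∈L U′∈L ext ext′)
                          (shortestPathExtension-base⊆ U′∈L U∈L ext′ ext)
    with w ≟ w′
  ... | yes refl = refl
  ... | no w≢w′  = contradiction (closer-trans U w′-closer w-closer) (closer-irrefl U)
    where
    open ShortestPathExtension
    w′-closer : Closer U w′ w
    w′-closer = interior-closer ext (w∈T ext′) (w∉U ext′) (w≢w′ ∘ ≡.sym)
    w-closer : Closer U w w′
    w-closer = interior-closer ext′ (w∈T ext) (w∉U ext) w≢w′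

  outsidePairs≤insidePairs : Connected G → length (outsidePairs L) ≤ length (insidePairs x L)
  outsidePairs≤insidePairs connected =
    length-≤-of-injection {R = Extends} (pairsOver-unique (proj₁ L-enumerates) (elements-unique ∘ ∁)) image injective
    where
    Extends : Subset n × Fin n → Subset n × Fin n → Set
    Extends (U , w) (T , a) = ShortestPathExtension U w T a

    image : ∀ {q} → q LM.∈ outsidePairs L → ∃[ q′ ] q′ LM.∈ insidePairs x L × Extends q q′
    image {U , w} q∈ with U∈L , w∈∁U ← ∈-pairsOver⁻ L q∈
      with T , a , ext ← shortestPathExtension-exists U connected U∈L (x∈∁p⇒x∉p (∈-elements⁻ w∈∁U)) =
      (T , a) , ∈-pairsOver⁺ T-listed (∈-elements⁺ (x∈p∧x≢y⇒x∈p-y a∈T a≢x)) , ext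
      where
      open ShortestPathExtension ext
      a≢x : a ≢ x
      a≢x refl = a∉U (root∈listed U∈L)

    injective : ∀ {q q′ t} → q LM.∈ outsidePairs L → q′ LM.∈ outsidePairs L → Extends q t → Extends q′ t → q ≡ q′
    injective {_ , _} {_ , _} {_ , _} q∈ q′∈ =
      shortestPathExtension-injective (proj₁ (∈-pairsOver⁻ L q∈)) (proj₁ (∈-pairsOver⁻ L q′∈))

corollary3p2 : ∀ (n : ℕ) (G : Graph n) → Connected G → (x : Fin n) → (L : List (Subset n)) → IsConnSetsAt G x L → suc n * Nsets L ≤ 2 * Ssizes L
corollary3p2 n G connected x L L-enumerates = begin
  suc n * N                           ≡⟨ cong (N +_) (length-outsidePairs L) ⟨
  N + (length (outsidePairs L) + S)   ≤⟨ +-monoʳ-≤ N (+-monoˡ-≤ S (outsidePairs≤insidePairs connected)) ⟩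
  N + (length (insidePairs x L) + S)  ≡⟨ +-assoc N _ S ⟨
  (N + length (insidePairs x L)) + S  ≡⟨ cong (_+ S) (+-comm N _) ⟩
  (length (insidePairs x L) + N) + S  ≡⟨ cong (_+ S) (length-insidePairs (All.tabulate root∈listed)) ⟩
  S + S                               ≡⟨ cong (S +_) (+-identityʳ S) ⟨
  2 * S                               ∎
  where
  open ConnectedSetsAt G x L L-enumerates
  open ≤-Reasoning
  N S : ℕ
  N = Nsets L
  S = Ssizes L
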